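{- Let $\mathbb{B}$ be a complete Boolean algebra and $\mathcal{A}_{\mathbb{B}}$ the associated realizability algebra. For any $t,s\in\Lambda$ and any closed formula $\varphi$ (with parameters in $\mathbf{N}$), if $\tau(t)=\tau(s)$ then $t\Vdash\varphi$ if and only if $s\Vdash\varphi$. In particular, if $t$ is a realizer then $t\Vdash\varphi$ if and only if $\mathsf{I}\Vdash\varphi$, where $\mathsf{I}=\lambda u.u$.
   Context: Krivine realizability basics: possibly open $\lambda_c$-terms are built from variables, application $ts$, abstraction $\lambda u.t$, $\mathsf{cc}$, and continuation constants $\mathsf{k}_\pi$ ($\pi\in\Pi$); $\Lambda$ is the set of closed terms, stacks $\Pi$ are built from stack bottoms and $t\cdot\pi$; realizers are terms containing no continuation constant. Processes are pairs $t\star\pi$. Names over a ZF model $\mathbf{V}$: $\mathbf{N}_\alpha=\bigcup_{\beta<\alpha}\mathcal{P}(\mathbf{N}_\beta\times\Pi)$, $\mathbf{N}=\bigcup_\alpha\mathbf{N}_\alpha$; each closed formula $\varphi$ with parameters in $\mathbf{N}$ has a falsity value $\|\varphi\|\subseteq\Pi$ (defined recursively: $\|\top\|=\emptyset$, $\|\perp\|=\Pi$, $\|a\not\varepsilon b\|=\{\pi:(a,\pi)\in b\}$, $\|a\notin b\|=\{t\cdot t'\cdot\pi:\exists c((c,\pi)\in b,t\Vdash a\subseteq c,t'\Vdash c\subseteq a)\}$, $\|a\subseteq b\|=\{t\cdot\pi:\exists c((c,\pi)\in a,t\Vdash c\notin b)\}$, $\|\varphi\to\psi\|=\{t\cdot\pi:t\Vdash\varphi,\pi\in\|\psi\|\}$,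 $\|\forall x\varphi\|=\bigcup_{a\in\mathbf{N}}\|\varphi(a)\|$), and $t\Vdash\varphi$ iff $t\star\pi\in\perp\!\!\!\perp$ for all $\pi\in\|\varphi\|$. The algebra $\mathcal{A}_{\mathbb{B}}$: no special instructions; stack bottoms $\omega_p$, one for each $p\in\mathbb{B}$. Define $\tau$ on terms and stacks: $\tau(\omega_p)=p$; $\tau(x)=\tau(\mathsf{cc})=\mathbb{1}$ for variables $x$; $\tau(t\cdot\pi)=\tau(t)\wedge\tau(\pi)$; $\tau(ts)=\tau(t)\wedge\tau(s)$; $\tau(\lambda u.t)=\tau(t)$; $\tau(\mathsf{k}_\pi)=\tau(\pi)$; and $\tau(t\star\pi)=\tau(t)\wedge\tau(\pi)$. The preorder is $t\star\pi\succ s\star\sigma$ iff $\tau(t\star\pi)\le\tau(s\star\sigma)$, and the pole is $\perp\!\!\!\perp=\{t\star\pi:\tau(t\star\pi)=\mathbb{0}\}$. -}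

module Defs where

open import Level using (Level; _⊔_) renaming (suc to lsuc)
open import Data.Nat using (ℕ; zero; suc)
open import Data.Fin using (Fin; zero; suc)
open import Data.Product using (Σ; _×_; _,_)
open import Data.Empty.Polymorphic using () renaming (⊥ to Empty)
open import Data.Unit.Polymorphic using () renaming (⊤ to Unit)
open import Relation.Binary.PropositionalEquality using (_≡_)
open import Algebra.Lattice.Bundles using (BooleanAlgebra)

record CompleteBooleanAlgebra (c ℓ : Level) : Set (lsuc (c ⊔ ℓ)) where
  field
    booleanAlgebra : BooleanAlgebra c ℓ
  open BooleanAlgebra booleanAlgebra public
  _≤_ : Carrier → Carrier → Set ℓ
  p ≤ q = (p ∧ q) ≈ p
  field
    sup       : (Carrier → Set c) → Carrier
    sup-upper : (S : Carrier → Set c) (p : Carrier) → S p → p ≤ sup S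
    sup-least : (S : Carrier → Set c) (q : Carrier) →
                ((p : Carrier) → S p → p ≤ q) → sup S ≤ q

module Realizability {c ℓ : Level} (𝔹 : CompleteBooleanAlgebra c ℓ) where
  open CompleteBooleanAlgebra 𝔹 renaming (⊤ to 𝟙; ⊥ to 𝟘)

  infixr 5 _·_

  -- λ_c-terms with n free (de Bruijn) variables, and stacks.
  -- No special instructions; stack bottoms ω p, one for each p ∈ 𝔹.
  mutual
    data Term (n : ℕ) : Set c where
      var : Fin n → Term n
      app : Term n → Term n → Term n
      lam : Term (suc n) → Term n
      cc  : Term n
      k   : Stack → Term n

    data Stack : Set c where
      ω   : Carrier → Stack
      _·_ : Term 0 → Stack → Stack

  Λ : Set c
  Λ = Term 0

  data NoK {n : ℕ} : Term n → Set c where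
    var : (x : Fin n) → NoK (var x)
    app : {t s : Term n} → NoK t → NoK s → NoK (app t s)
    lam : {t : Term (suc n)} → NoK {suc n} t → NoK (lam t)
    cc  : NoK cc

  Realizer : Λ → Set c
  Realizer t = NoK t

  I : Λ
  I = lam (var zero)

  mutual
    τ : {n : ℕ} → Term n → Carrier
    τ (var x)   = 𝟙
    τ (app t s) = τ t ∧ τ s
    τ (lam t)   = τ t
    τ cc        = 𝟙
    τ (k π)     = τˢ π

    τˢ : Stack → Carrier
    τˢ (ω p)   = p
    τˢ (t · π) = τ t ∧ τˢ π

  record Process : Set c where
    constructor _⋆_
    field
      term  : Λ
      stack : Stack

  τᵖ : Process → Carrier
  τᵖ (t ⋆ π) = τ t ∧ τˢ π

  Pole : Process → Set ℓ
  Pole p = τᵖ p ≈ 𝟘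

  _⊩ᶠ_ : {a : Level} → Λ → (Stack → Set a) → Set (c ⊔ ℓ ⊔ a)
  t ⊩ᶠ F = (π : Stack) → F π → Pole (t ⋆ π)

  -- Names: N_α = ⋃_{β<α} P(N_β × Π), represented as well-founded trees:
  -- a name is an (indexed) set of pairs (name, stack).
  data Name : Set (lsuc c) where
    mk : (I : Set c) → (I → Name) → (I → Stack) → Name

  _,_∈ₙ_ : Name → Stack → Name → Set (lsuc c)
  a , π ∈ₙ mk J f g = Σ J λ j → (f j ≡ a) × (g j ≡ π)

  mutual
    ‖_∉_‖ : Name → Name → Stack → Set (lsuc c ⊔ ℓ)
    ‖ a ∉ mk J f g ‖ ρ =
      Σ J λ j → Σ Λ λ t → Σ Λ λ t' →
        (ρ ≡ t · t' · g j) ×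
        ((t ⊩ᶠ ‖ a ⊆ f j ‖) × (t' ⊩ᶠ ‖ f j ⊆ a ‖))

    ‖_⊆_‖ : Name → Name → Stack → Set (lsuc c ⊔ ℓ)
    ‖ mk J f g ⊆ b ‖ ρ =
      Σ J λ j → Σ Λ λ t →
        (ρ ≡ t · g j) × (t ⊩ᶠ ‖ f j ∉ b ‖)

  data NTerm (n : ℕ) : Set (lsuc c) where
    var : Fin n → NTerm n
    par : Name → NTerm n

  infixr 4 _⇒_
  data Formula (n : ℕ) : Set (lsuc c) where
    ⊤'   : Formula n
    ⊥'   : Formula n
    _∉ε_ : NTerm n → NTerm n → Formula n
    _∉'_ : NTerm n → NTerm n → Formula n
    _⊆'_ : NTerm n → NTerm n → Formula n
    _⇒_  : Formula n → Formula n → Formula n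
    ∀'   : Formula (suc n) → Formula n

  ClosedFormula : Set (lsuc c)
  ClosedFormula = Formula 0

  Env : ℕ → Set (lsuc c)
  Env n = Fin n → Name

  extend : {n : ℕ} → Name → Env n → Env (suc n)
  extend a ρ zero    = a
  extend a ρ (suc x) = ρ x

  evalN : {n : ℕ} → Env n → NTerm n → Name
  evalN ρ (var x) = ρ x
  evalN ρ (par a) = a

  ‖_‖⟨_⟩ : {n : ℕ} → Formula n → Env n → Stack → Set (lsuc c ⊔ ℓ)
  ‖ ⊤' ‖⟨ ρ ⟩ π = Empty
  ‖ ⊥' ‖⟨ ρ ⟩ π = Unit
  ‖ a ∉ε b ‖⟨ ρ ⟩ π = Lift' (evalN ρ a , π ∈ₙ evalN ρ b)
    where Lift' : Set (lsuc c) → Set (lsuc c ⊔ ℓ)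
          Lift' A = Level.Lift (lsuc c ⊔ ℓ) A
  ‖ a ∉' b ‖⟨ ρ ⟩ π = ‖ evalN ρ a ∉ evalN ρ b ‖ π
  ‖ a ⊆' b ‖⟨ ρ ⟩ π = ‖ evalN ρ a ⊆ evalN ρ b ‖ π
  ‖ φ ⇒ ψ ‖⟨ ρ ⟩ (ω p)   = Empty
  ‖ φ ⇒ ψ ‖⟨ ρ ⟩ (t · π) = (t ⊩ᶠ ‖ φ ‖⟨ ρ ⟩) × ‖ ψ ‖⟨ ρ ⟩ π
  ‖ ∀' φ ‖⟨ ρ ⟩ π = Σ Name λ a → ‖ φ ‖⟨ extend a ρ ⟩ π

  emptyEnv : Env 0
  emptyEnv ()

  ‖_‖ : ClosedFormula → Stack → Set (lsuc c ⊔ ℓ)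
  ‖ φ ‖ = ‖ φ ‖⟨ emptyEnv ⟩

  infix 3 _⊩_
  _⊩_ : Λ → ClosedFormula → Set (lsuc c ⊔ ℓ)
  t ⊩ φ = t ⊩ᶠ ‖ φ ‖

{-# OPTIONS --safe #-}
module Submission where

open import Defs
open import Data.Product using (_×_; _,_)
open import Function.Bundles using (_⇔_; mk⇔)
import Algebra.Lattice.Properties.Lattice as LatticeProperties

-- Whether t ⋆ π lies in the pole depends on t only through τ t, so any two
-- terms with the same τ realize exactly the same falsity values, whatever the
-- formula.  A term without continuation constants has τ = 𝟙, as does I.

module _ {c ℓ} (𝔹 : CompleteBooleanAlgebra c ℓ) where
  open CompleteBooleanAlgebra 𝔹 renaming (⊤ to 𝟙)
  open Realizability 𝔹
  open LatticeProperties lattice using (∧-idem)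

  pole-respects-τ : (t s : Λ) (π : Stack) → τ t ≈ τ s → Pole (t ⋆ π) → Pole (s ⋆ π)
  pole-respects-τ t s π τt≈τs t⋆π∈⊥⊥ = trans (∧-cong (sym τt≈τs) refl) t⋆π∈⊥⊥

  ⊩ᶠ-respects-τ : (t s : Λ) → τ t ≈ τ s → ∀ {a} (F : Stack → Set a) → t ⊩ᶠ F → s ⊩ᶠ F
  ⊩ᶠ-respects-τ t s τt≈τs F t⊩F π π∈F = pole-respects-τ t s π τt≈τs (t⊩F π π∈F)

  ⊩ᶠ-cong-τ : (t s : Λ) → τ t ≈ τ s → ∀ {a} (F : Stack → Set a) → (t ⊩ᶠ F) ⇔ (s ⊩ᶠ F)
  ⊩ᶠ-cong-τ t s τt≈τs F = mk⇔ (⊩ᶠ-respects-τ t s τt≈τs F) (⊩ᶠ-respects-τ s t (sym τt≈τs) F)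

  τ-NoK : ∀ {n} {t : Term n} → NoK t → τ t ≈ 𝟙
  τ-NoK (var x)   = refl
  τ-NoK (app t s) = trans (∧-cong (τ-NoK t) (τ-NoK s)) (∧-idem 𝟙)
  τ-NoK (lam t)   = τ-NoK t
  τ-NoK cc        = refl

proposition19p2 : ∀ {c ℓ} (𝔹 : CompleteBooleanAlgebra c ℓ) →
    let open CompleteBooleanAlgebra 𝔹 using (_≈_)
        open Realizability 𝔹
    in ((t s : Λ) (φ : ClosedFormula) → τ t ≈ τ s → ((t ⊩ φ) ⇔ (s ⊩ φ)))
       × ((t : Λ) → Realizer t → (φ : ClosedFormula) → ((t ⊩ φ) ⇔ (I ⊩ φ)))
proposition19p2 𝔹 =
  (λ t s φ τt≈τs → ⊩ᶠ-cong-τ 𝔹 t s τt≈τs ‖ φ ‖) ,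
  (λ t t-realizer φ → ⊩ᶠ-cong-τ 𝔹 t I (τ-NoK 𝔹 t-realizer) ‖ φ ‖)
  where open Realizability 𝔹
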